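{- Let $n\ge 7$ and let $G$ be a graph isomorphic to $C(\pi)$ for some $\pi\in\mathcal{S}_n$. (i) If $G$ contains $K_{1,3}$ as an induced subgraph, then $G$ is not isomorphic to $C(\sigma)$ for any $\sigma\in\mathcal{S}_n(123)$. (ii) If $G$ contains $P_3$ as an induced subgraph, then $G$ is not isomorphic to $C(\sigma)$ for any $\sigma\in\mathcal{S}_n(132)$.
   Context: For $\pi=\pi_1\cdots\pi_n\in\mathcal{S}_n$, $C(\pi)$ is the simple graph on vertex set $\{1,\dots,n\}$ in which distinct $i,j$ are adjacent iff there exists $k$ with $k<i$, $k<j$, $\pi_k<\pi_i$ and $\pi_k<\pi_j$ (the competition graph of the digraph with an arc from $j$ to $i$ whenever $i<j$ and $\pi_i<\pi_j$). $\mathcal{S}_n(\tau)$ is the set of $\tau$-avoiding permutations in $\mathcal{S}_n$. $K_{1,3}$ is the star with one center and three leaves; $P_3$ is the path with $4$ vertices and $3$ edges. -}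

module Defs where

open import Data.Nat using (ℕ)
open import Data.Fin using (Fin; _<_)
open import Data.Fin.Permutation using (Permutation′; _⟨$⟩ʳ_)
open import Data.Product using (Σ; ∃; _×_)
open import Relation.Binary.PropositionalEquality using (_≡_; _≢_)
open import Relation.Nullary using (¬_)
open import Function.Bundles using (_↔_; _⇔_; Inverse)

Perm : ℕ → Set
Perm n = Permutation′ n

-- Adjacency of the graph C(π) on vertex set Fin n (positions 1..n ↦ 0..n-1).
CAdj : ∀ {n} → Perm n → Fin n → Fin n → Set
CAdj {n} π i j =
  i ≢ j × ∃ λ (k : Fin n) →
    (k < i) × (k < j) × ((π ⟨$⟩ʳ k) < (π ⟨$⟩ʳ i)) × ((π ⟨$⟩ʳ k) < (π ⟨$⟩ʳ j))

IsoTo : (V : Set) → (V → V → Set) → (n : ℕ) → (Fin n → Fin n → Set) → Set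
IsoTo V E n R =
  Σ (V ↔ Fin n) λ f → ∀ u v → E u v ⇔ R (Inverse.to f u) (Inverse.to f v)

HasInducedK13 : (V : Set) → (V → V → Set) → Set
HasInducedK13 V E = Σ V λ c → Σ V λ a → Σ V λ b → Σ V λ d →
  (c ≢ a) × (c ≢ b) × (c ≢ d) × (a ≢ b) × (a ≢ d) × (b ≢ d) ×
  E c a × E c b × E c d × ¬ E a b × ¬ E a d × ¬ E b d

-- (V, E) contains the path P_3 = a - b - c - d (4 vertices) as an induced subgraph.
HasInducedP3 : (V : Set) → (V → V → Set) → Set
HasInducedP3 V E = Σ V λ a → Σ V λ b → Σ V λ c → Σ V λ d →
  (a ≢ b) × (a ≢ c) × (a ≢ d) × (b ≢ c) × (b ≢ d) × (c ≢ d) ×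
  E a b × E b c × E c d × ¬ E a c × ¬ E a d × ¬ E b d

Avoids123 : ∀ {n} → Perm n → Set
Avoids123 {n} σ = ∀ (i j k : Fin n) → i < j → j < k →
  ¬ (((σ ⟨$⟩ʳ i) < (σ ⟨$⟩ʳ j)) × ((σ ⟨$⟩ʳ j) < (σ ⟨$⟩ʳ k)))

Avoids132 : ∀ {n} → Perm n → Set
Avoids132 {n} σ = ∀ (i j k : Fin n) → i < j → j < k →
  ¬ (((σ ⟨$⟩ʳ i) < (σ ⟨$⟩ʳ k)) × ((σ ⟨$⟩ʳ k) < (σ ⟨$⟩ʳ j)))

module Submission where

-- Both parts are forbidden-subgraph statements, so the graph G
-- only enters through an isomorphism G ≅ C(σ): an isomorphism carries an
-- induced K_{1,3} (resp. P_3) of G to one of C(σ), and it then suffices to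
-- show that C(σ) itself has no such induced subgraph.
--
-- (i)  If σ avoids 123 then every non-isolated vertex y of C(σ) satisfies
--      σ_z < σ_y for all z > y.  Hence a non-isolated vertex lying strictly
--      between two adjacent vertices is adjacent to both of them, so any two
--      neighbours of a vertex c on the same side of c are adjacent.  Among
--      three leaves of a claw two lie on the same side of the centre.
-- (ii) In any C(σ) the neighbours of x to the right of x form a clique, and
--      if σ avoids 132 then adjacency is transitive along increasing
--      positions.  Together: in an induced path a - b - c the middle vertex
--      lies to the right of c.  Applied to a - b - c and d - c - b inside an
--      induced P_3 = a - b - c - d this gives c < b and b < c.

open import Defs
open import Data.Nat using (ℕ; _≤_)
open import Data.Product using (Σ; _×_; _,_; proj₁; proj₂)
open import Data.Fin using (Fin; _<_)
open import Data.Fin.Properties using (<-cmp; <-trans; <-asym; <⇒≢)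
open import Data.Fin.Permutation using (_⟨$⟩ʳ_)
open import Data.Empty using (⊥-elim)
open import Function using (_∘_)
open import Function.Bundles using (_↔_; Inverse; Injection; Equivalence)
open import Function.Properties.Inverse using (↔⇒↣)
open import Relation.Binary.Definitions using (tri<; tri≈; tri>)
open import Relation.Binary.PropositionalEquality using (_≡_; _≢_; sym; subst)
open import Relation.Nullary using (¬_)

module Transport {V : Set} {E : V → V → Set} {n : ℕ} {R : Fin n → Fin n → Set}
                 (iso : IsoTo V E n R) where
  private
    f : V ↔ Fin n
    f = proj₁ iso

    g : V → Fin n
    g = Inverse.to f

  map-≢ : ∀ {x y} → x ≢ y → g x ≢ g y
  map-≢ x≢y = x≢y ∘ Injection.injective (↔⇒↣ f)

  map-edge : ∀ {x y} → E x y → R (g x) (g y)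
  map-edge {x} {y} = Equivalence.to (proj₂ iso x y)

  map-nonedge : ∀ {x y} → ¬ E x y → ¬ R (g x) (g y)
  map-nonedge {x} {y} ¬e = ¬e ∘ Equivalence.from (proj₂ iso x y)

  inducedK13 : HasInducedK13 V E → HasInducedK13 (Fin n) R
  inducedK13 (c , a , b , d , ca , cb , cd , ab , ad , bd , ec , eb , ed , nab , nad , nbd) =
    g c , g a , g b , g d ,
    map-≢ ca , map-≢ cb , map-≢ cd , map-≢ ab , map-≢ ad , map-≢ bd ,
    map-edge ec , map-edge eb , map-edge ed ,
    map-nonedge nab , map-nonedge nad , map-nonedge nbd

  inducedP3 : HasInducedP3 V E → HasInducedP3 (Fin n) R
  inducedP3 (a , b , c , d , ab , ac , ad , bc , bd , cd , eab , ebc , ecd , nac , nad , nbd) =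
    g a , g b , g c , g d ,
    map-≢ ab , map-≢ ac , map-≢ ad , map-≢ bc , map-≢ bd , map-≢ cd ,
    map-edge eab , map-edge ebc , map-edge ecd ,
    map-nonedge nac , map-nonedge nad , map-nonedge nbd

module Competition {n : ℕ} (σ : Perm n) where
  private
    v : Fin n → Fin n
    v i = σ ⟨$⟩ʳ i

    v-injective : ∀ {x y} → v x ≡ v y → x ≡ y
    v-injective = Injection.injective (↔⇒↣ σ)

  Adj : Fin n → Fin n → Set
  Adj = CAdj σ

  Adj-sym : ∀ {x y} → Adj x y → Adj y x
  Adj-sym (x≢y , k , kx , ky , vkx , vky) = x≢y ∘ sym , k , ky , kx , vky , vkx

  -- The right neighbourhood of any vertex is a clique: use whichever of the
  -- two witnesses has the smaller value.
  right-clique : ∀ {x y z} → y ≢ z → x < y → x < z → Adj x y → Adj x z → Adj y z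
  right-clique {x} {y} {z} y≢z x<y x<z (_ , k , kx , ky , _ , vky) (_ , l , lx , lz , _ , vlz)
    with <-cmp (v k) (v l)
  ... | tri< vk<vl _ _ = y≢z , k , ky , <-trans kx x<z , vky , <-trans vk<vl vlz
  ... | tri≈ _ vk≡vl _ = y≢z , k , ky , <-trans kx x<z , vky ,
                         subst (λ m → v m < v z) (sym (v-injective vk≡vl)) vlz
  ... | tri> _ _ vl<vk = y≢z , l , <-trans lx x<y , lz , <-trans vl<vk vky , vlz

  module Avoiding123 (avoid : Avoids123 σ) where

    -- A vertex with a neighbour has a smaller value before it, so (no 123)
    -- every later vertex has a smaller value.
    later-smaller : ∀ {x y} → Adj x y → ∀ z → y < z → v z < v y
    later-smaller {y = y} (_ , k , _ , ky , _ , vky) z y<z with <-cmp (v z) (v y)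
    ... | tri< vz<vy _ _ = vz<vy
    ... | tri≈ _ vz≡vy _ = ⊥-elim (<⇒≢ y<z (sym (v-injective vz≡vy)))
    ... | tri> _ _ vy<vz = ⊥-elim (avoid k y z ky y<z (vky , vy<vz))

    -- A non-isolated vertex strictly between two adjacent vertices is adjacent
    -- to both: the witness of x ~ z also works for x ~ y and y ~ z.
    between-adjacent : ∀ {x y z w} → x < y → y < z → Adj x z → Adj y w → Adj x y × Adj y z
    between-adjacent {z = z} x<y y<z (_ , k , kx , kz , vkx , vkz) yw =
      (<⇒≢ x<y , k , kx , ky , vkx , vkz<vy) ,
      (<⇒≢ y<z , k , ky , kz , vkz<vy , vkz)
      where
        ky = <-trans kx x<y
        vkz<vy = <-trans vkz (later-smaller (Adj-sym yw) z y<z)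

    right-neighbours-adjacent : ∀ {c u w} → u ≢ w → c < u → c < w →
                                Adj c u → Adj c w → Adj u w
    right-neighbours-adjacent {u = u} {w} u≢w c<u c<w cu cw with <-cmp u w
    ... | tri< u<w _ _ = proj₂ (between-adjacent c<u u<w cw (Adj-sym cu))
    ... | tri≈ _ u≡w _ = ⊥-elim (u≢w u≡w)
    ... | tri> _ _ w<u = Adj-sym (proj₂ (between-adjacent c<w w<u cu (Adj-sym cw)))

    left-neighbours-adjacent : ∀ {c u w} → u ≢ w → u < c → w < c →
                               Adj c u → Adj c w → Adj u w
    left-neighbours-adjacent {u = u} {w} u≢w u<c w<c cu cw with <-cmp u w
    ... | tri< u<w _ _ = proj₁ (between-adjacent u<w w<c (Adj-sym cu) (Adj-sym cw))
    ... | tri≈ _ u≡w _ = ⊥-elim (u≢w u≡w)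
    ... | tri> _ _ w<u = Adj-sym (proj₁ (between-adjacent w<u u<c (Adj-sym cw) (Adj-sym cu)))

    data Side (c u : Fin n) : Set where
      left  : u < c → Side c u
      right : c < u → Side c u

    side : ∀ {c u} → Adj c u → Side c u
    side {c} {u} (c≢u , _) with <-cmp c u
    ... | tri< c<u _ _ = right c<u
    ... | tri≈ _ c≡u _ = ⊥-elim (c≢u c≡u)
    ... | tri> _ _ u<c = left u<c

    -- By pigeonhole two of the three leaves are on the same side of c.
    claw-free : ¬ HasInducedK13 (Fin n) Adj
    claw-free (c , a , b , d , _ , _ , _ , a≢b , a≢d , b≢d , ca , cb , cd , ¬ab , ¬ad , ¬bd)
      with side ca | side cb | side cd
    ... | left  p | left  q | _       = ¬ab (left-neighbours-adjacent a≢b p q ca cb)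
    ... | right p | right q | _       = ¬ab (right-neighbours-adjacent a≢b p q ca cb)
    ... | left  p | right _ | left  r = ¬ad (left-neighbours-adjacent a≢d p r ca cd)
    ... | right p | left  _ | right r = ¬ad (right-neighbours-adjacent a≢d p r ca cd)
    ... | left  _ | right q | right r = ¬bd (right-neighbours-adjacent b≢d q r cb cd)
    ... | right _ | left  q | left  r = ¬bd (left-neighbours-adjacent b≢d q r cb cd)

  module Avoiding132 (avoid : Avoids132 σ) where

    -- With witnesses
    -- k of x ~ y and l of y ~ z, avoiding 132 forces v k < v z (pattern
    -- k y z) and then v x < v z (pattern k x z), so k witnesses x ~ z.
    increasing-transitive : ∀ {x y z} → x < y → y < z → Adj x y → Adj y z → Adj x z
    increasing-transitive {x} {y} {z} x<y y<z (_ , k , kx , _ , vkx , vky) (_ , l , ly , _ , _ , vlz)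
      with <-cmp (v z) (v k)
    ... | tri< vz<vk _ _ = ⊥-elim (avoid l y z ly y<z (vlz , <-trans vz<vk vky))
    ... | tri≈ _ vz≡vk _ = ⊥-elim (<⇒≢ (<-trans kx x<z) (sym (v-injective vz≡vk)))
      where x<z = <-trans x<y y<z
    ... | tri> _ _ vk<vz = <⇒≢ x<z , k , kx , <-trans kx x<z , vkx , vk<vz
      where x<z = <-trans x<y y<z

    -- In an induced path a - b - c the middle vertex lies right of c: if
    -- b < c, then a < b gives a ~ c by transitivity and b < a gives a ~ c
    -- because the right neighbourhood of b is a clique.
    induced-path-middle : ∀ {a b c} → a ≢ c → Adj a b → Adj b c → ¬ Adj a c → c < b
    induced-path-middle {a} {b} {c} a≢c ab bc ¬ac with <-cmp b c
    ... | tri≈ _ b≡c _ = ⊥-elim (proj₁ bc b≡c)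
    ... | tri> _ _ c<b = c<b
    ... | tri< b<c _ _ with <-cmp a b
    ...   | tri< a<b _ _ = ⊥-elim (¬ac (increasing-transitive a<b b<c ab bc))
    ...   | tri≈ _ a≡b _ = ⊥-elim (proj₁ ab a≡b)
    ...   | tri> _ _ b<a = ⊥-elim (¬ac (Adj-sym (right-clique (a≢c ∘ sym) b<c b<a bc (Adj-sym ab))))

    P3-free : ¬ HasInducedP3 (Fin n) Adj
    P3-free (a , b , c , d , _ , a≢c , _ , _ , b≢d , _ , ab , bc , cd , ¬ac , _ , ¬bd) =
      <-asym (induced-path-middle a≢c ab bc ¬ac)
             (induced-path-middle (b≢d ∘ sym) (Adj-sym cd) (Adj-sym bc) (¬bd ∘ Adj-sym))

mainTheorem5 : (n : ℕ) → 7 ≤ n → (V : Set) → (E : V → V → Set) →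
    Σ (Perm n) (λ π → IsoTo V E n (CAdj π)) →
    ((HasInducedK13 V E →
        (σ : Perm n) → Avoids123 σ → ¬ IsoTo V E n (CAdj σ))
     × (HasInducedP3 V E →
        (σ : Perm n) → Avoids132 σ → ¬ IsoTo V E n (CAdj σ)))
mainTheorem5 n _ V E _ =
  (λ claw σ avoid iso →
     Competition.Avoiding123.claw-free σ avoid (Transport.inducedK13 iso claw)) ,
  (λ path σ avoid iso →
     Competition.Avoiding132.P3-free σ avoid (Transport.inducedP3 iso path))
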